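{- Let $a,b,c\geq 2$ be pairwise relatively prime integers. Let $M_c$ be the number of pairs of positive integers $(n,m)$ with $an+bm=c$ ($M_c=0$ if there is no such pair). Then $M_c=p(c;\{a,b\})$. Moreover, for every integer $N\geq1$ and every prime $\ell$, \[M_{c+\pi_{\ell^N}}\equiv M_c\pmod{\ell^N},\] where $\pi_{\ell^N}$ is the minimum period modulo $\ell^N$ of the $q$-series $\sum_{n\geq0}p(n;\{a,b\})q^n=\frac{1}{(1-q^a)(1-q^b)}$, and for an integer $d$, $M_d$ denotes the number of pairs of positive integers $(n,m)$ with $an+bm=d$.
   Context: For a set $S$ of positive integers, $p(n;S)$ denotes the number of partitions of $n$ into parts from $S$, so $\sum_{n\geq0}p(n;S)q^n=\prod_{s\in S}(1-q^s)^{ -1}$. A power series $A(q)=\sum_{n\geq0}\alpha(n)q^n\in\mathbb{Z}[[q]]$ is (purely) periodic with period $d\geq1$ modulo $L$ if $\alpha(n+d)\equiv\alpha(n)\pmod L$ for all $n\geq0$; the minimum period modulo $L$ is the smallest such $d$ (it exists for $\frac{1}{(1-q^a)(1-q^b)}$ modulo any prime power). -}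

module Defs where

open import Data.Nat using (ℕ; zero; suc; _+_; _*_; _∸_; _≤_; _≤?_; _≟_)
open import Data.Bool using (if_then_else_)
open import Data.List using (List; []; _∷_)
open import Data.Product using (_×_)
open import Relation.Nullary using (does)
open import Data.Integer as ℤ using (ℤ; +_)
open import Data.Integer.Divisibility as ℤD using ()

sumRange : ℕ → (ℕ → ℕ) → ℕ
sumRange zero    f = 0
sumRange (suc n) f = sumRange n f + f n

[_≡ᵇ_] : ℕ → ℕ → ℕ
[ x ≡ᵇ y ] = if does (x ≟ y) then 1 else 0

[_≤ᵇ_] : ℕ → ℕ → ℕ
[ x ≤ᵇ y ] = if does (x ≤? y) then 1 else 0

-- p(n;S) for a finite set S of positive integers given as a list of
-- distinct elements: number of ways to write n = Σ_{s∈S} k_s · s with k_s ≥ 0,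
-- i.e. the number of partitions of n into parts from S.
partS : List ℕ → ℕ → ℕ
partS []      n = [ n ≡ᵇ 0 ]
partS (s ∷ S) n = sumRange (suc n) (λ k → [ k * s ≤ᵇ n ] * partS S (n ∸ k * s))

p₂ : ℕ → ℕ → ℕ → ℕ
p₂ a b n = partS (a ∷ b ∷ []) n

-- M_d (for a,b): number of pairs of positive integers (n,m) with a n + b m = d.
-- Positive n,m with a,b ≥ 1 satisfy n,m ≤ d, so we sum over n,m ∈ {1,…,d}.
M : ℕ → ℕ → ℕ → ℕ
M a b d = sumRange d (λ i → sumRange d (λ j → [ a * suc i + b * suc j ≡ᵇ d ]))

_≡_[mod_] : ℕ → ℕ → ℕ → Set
x ≡ y [mod L ] = (+ L) ℤD.∣ ((+ x) ℤ.- (+ y))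

IsPeriodMod : (ℕ → ℕ) → ℕ → ℕ → Set
IsPeriodMod α L d = (1 ≤ d) × (∀ n → α (n + d) ≡ α n [mod L ])

IsMinPeriodMod : (ℕ → ℕ) → ℕ → ℕ → Set
IsMinPeriodMod α L d = IsPeriodMod α L d × (∀ d′ → IsPeriodMod α L d′ → d ≤ d′)

{-# OPTIONS --safe #-}
-- p(n;{a,b}) counts the solutions of a i + b j = n with i, j ≥ 0 and M_n those with i, j ≥ 1;
-- the two agree when a ∤ n and b ∤ n, since then no solution has a zero coordinate.
-- Separating the solutions with i = 0 gives p(a + n) = [b ∣ a + n] + p(n), so a period π of p
-- modulo L ≠ 1 is also a period of [b ∣ ·] on arguments ≥ a; at a b this forces b ∣ π, and
-- symmetrically a ∣ π. Hence a, b ∤ c + π and M_{c+π} = p(c + π) ≡ p(c) = M_c.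
module Submission where

open import Defs
open import Data.Nat using (ℕ; _+_; _≤_; _^_)
open import Data.Nat.Coprimality using (Coprime)
open import Data.Nat.Primality using (Prime)
open import Data.Product using (_×_)
open import Relation.Binary.PropositionalEquality using (_≡_)

open import Data.Nat
  using (zero; suc; _*_; _∸_; _<_; _≤′_; ≤′-refl; ≤′-step; _≟_; _≤?_; s≤s; nonTrivial⇒≢1; >-nonZero)
open import Data.Nat.Properties
open import Algebra.Properties.CommutativeSemigroup +-commutativeSemigroup
  using () renaming (interchange to +-interchange)
open import Data.Nat.Divisibility
  using (_∣_; _∤_; divides; ∣-refl; ∣m+n∣m⇒∣n; ∣1⇒≡1; n∣m*n)
open import Data.Nat.Primality using (prime⇒nonTrivial)
open import Data.Product using (_,_; ∃)
open import Data.Sum using (inj₁; inj₂)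
open import Data.Bool using (if_then_else_)
open import Data.List using ([]; _∷_)
open import Data.Empty using (⊥-elim)
open import Function using (_∘_; _⇔_; mk⇔)
open import Relation.Nullary using (¬_; Dec; does; yes; no)
open import Relation.Nullary.Decidable using (dec-true; dec-false; does-⇔; decidable-stable)
open import Relation.Binary.PropositionalEquality
  using (_≢_; _≗_; refl; sym; trans; cong; cong₂; subst; subst₂; module ≡-Reasoning)
import Data.Integer as ℤ
import Data.Integer.Properties as ℤ
import Data.Integer.Divisibility.Signed as ℤ-Signed
import Data.Integer.Tactic.RingSolver as ℤ-Solver

sumRange-cong : ∀ R {f g : ℕ → ℕ} → (∀ i → i < R → f i ≡ g i) → sumRange R f ≡ sumRange R g
sumRange-cong zero    _   = refl
sumRange-cong (suc R) f≡g =
  cong₂ _+_ (sumRange-cong R (λ i i<R → f≡g i (m<n⇒m<1+n i<R))) (f≡g R ≤-refl)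

sumRange-zero : ∀ R {f : ℕ → ℕ} → (∀ i → i < R → f i ≡ 0) → sumRange R f ≡ 0
sumRange-zero zero    _    = refl
sumRange-zero (suc R) f≡0 =
  cong₂ _+_ (sumRange-zero R (λ i i<R → f≡0 i (m<n⇒m<1+n i<R))) (f≡0 R ≤-refl)

sumRange-extend : ∀ {R S} (f : ℕ → ℕ) → R ≤ S → (∀ i → R ≤ i → f i ≡ 0) →
                  sumRange S f ≡ sumRange R f
sumRange-extend {R} f R≤S f≡0 = go (≤⇒≤′ R≤S)
  where
  go : ∀ {S} → R ≤′ S → sumRange S f ≡ sumRange R f
  go ≤′-refl         = refl
  go (≤′-step R≤′S) = trans (cong₂ _+_ (go R≤′S) (f≡0 _ (≤′⇒≤ R≤′S))) (+-identityʳ _)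

sumRange-suc : ∀ R (f : ℕ → ℕ) → sumRange (suc R) f ≡ f 0 + sumRange R (f ∘ suc)
sumRange-suc zero    f = sym (+-identityʳ (f 0))
sumRange-suc (suc R) f = trans (cong (_+ f (suc R)) (sumRange-suc R f)) (+-assoc (f 0) _ _)

sumRange-+ : ∀ R (f g : ℕ → ℕ) → sumRange R (λ i → f i + g i) ≡ sumRange R f + sumRange R g
sumRange-+ zero    f g = refl
sumRange-+ (suc R) f g =
  trans (cong (_+ (f R + g R)) (sumRange-+ R f g))
        (+-interchange (sumRange R f) (sumRange R g) (f R) (g R))

sumRange-swap : ∀ R S (f : ℕ → ℕ → ℕ) →
  sumRange R (λ i → sumRange S (f i)) ≡ sumRange S (λ j → sumRange R (λ i → f i j))
sumRange-swap zero    S f = sym (sumRange-zero S (λ _ _ → refl))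
sumRange-swap (suc R) S f =
  trans (cong (_+ sumRange S (f R)) (sumRange-swap R S f))
        (sym (sumRange-+ S (λ j → sumRange R (λ i → f i j)) (f R)))

sumRange-single : ∀ {R k} (f : ℕ → ℕ) → k < R → (∀ i → i ≢ k → f i ≡ 0) → sumRange R f ≡ f k
sumRange-single {R} {k} f k<R f≡0 = begin
  sumRange R f        ≡⟨ sumRange-extend f k<R (λ i k<i → f≡0 i (>⇒≢ k<i)) ⟩
  sumRange (suc k) f  ≡⟨ cong (_+ f k) (sumRange-zero k (λ i i<k → f≡0 i (<⇒≢ i<k))) ⟩
  f k                 ∎
  where open ≡-Reasoning

sumRange-≢0 : ∀ R (f : ℕ → ℕ) → sumRange R f ≢ 0 → ∃ λ i → f i ≢ 0
sumRange-≢0 zero    f sum≢0 = ⊥-elim (sum≢0 refl)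
sumRange-≢0 (suc R) f sum≢0 with f R ≟ 0
... | no  fR≢0 = R , fR≢0
... | yes fR≡0 = sumRange-≢0 R f (λ sum≡0 → sum≢0 (cong₂ _+_ sum≡0 fR≡0))

-- [ x ≡ᵇ y ] and [ x ≤ᵇ y ] unfold to indicator (x ≟ y) and indicator (x ≤? y).
indicator : ∀ {p} {P : Set p} → Dec P → ℕ
indicator P? = if does P? then 1 else 0

module _ {p} {P : Set p} (P? : Dec P) where

  indicator-yes : P → indicator P? ≡ 1
  indicator-yes p = cong (λ b → if b then 1 else 0) (dec-true P? p)

  indicator-no : ¬ P → indicator P? ≡ 0
  indicator-no ¬p = cong (λ b → if b then 1 else 0) (dec-false P? ¬p)

  indicator-≢0 : indicator P? ≢ 0 → P
  indicator-≢0 ≢0 = decidable-stable P? (≢0 ∘ indicator-no)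

indicator-⇔ : ∀ {p q} {P : Set p} {Q : Set q} → P ⇔ Q → (P? : Dec P) (Q? : Dec Q) →
              indicator P? ≡ indicator Q?
indicator-⇔ P⇔Q P? Q? = cong (λ b → if b then 1 else 0) (does-⇔ P⇔Q P? Q?)

partS-singleton : ∀ b m → partS (b ∷ []) m ≡ sumRange (suc m) (λ j → [ j * b ≡ᵇ m ])
partS-singleton b m = sumRange-cong (suc m) (λ j _ → exact (j * b))
  where
  open ≡-Reasoning
  exact : ∀ x → [ x ≤ᵇ m ] * [ m ∸ x ≡ᵇ 0 ] ≡ [ x ≡ᵇ m ]
  exact x with x ≤? m
  ... | yes x≤m = begin
    [ x ≤ᵇ m ] * [ m ∸ x ≡ᵇ 0 ] ≡⟨ cong (_* [ m ∸ x ≡ᵇ 0 ]) (indicator-yes (x ≤? m) x≤m) ⟩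
    1 * [ m ∸ x ≡ᵇ 0 ]          ≡⟨ *-identityˡ _ ⟩
    [ m ∸ x ≡ᵇ 0 ]              ≡⟨ indicator-⇔ m∸x≡0⇔x≡m (m ∸ x ≟ 0) (x ≟ m) ⟩
    [ x ≡ᵇ m ]                  ∎
    where
    m∸x≡0⇔x≡m : m ∸ x ≡ 0 ⇔ x ≡ m
    m∸x≡0⇔x≡m = mk⇔ (λ m∸x≡0 → ≤-antisym x≤m (m∸n≡0⇒m≤n m∸x≡0))
                    (λ { refl → n∸n≡0 x })
  ... | no x≰m = trans (cong (_* [ m ∸ x ≡ᵇ 0 ]) (indicator-no (x ≤? m) x≰m))
                       (sym (indicator-no (x ≟ m) (x≰m ∘ ≤-reflexive)))

partS-singleton-multiple : ∀ {b} k → 1 ≤ b → partS (b ∷ []) (k * b) ≡ 1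
partS-singleton-multiple {b} k 1≤b = begin
  partS (b ∷ []) (k * b)                            ≡⟨ partS-singleton b (k * b) ⟩
  sumRange (suc (k * b)) (λ j → [ j * b ≡ᵇ k * b ])
    ≡⟨ sumRange-single _ (s≤s (m≤m*n k b)) vanish ⟩
  [ k * b ≡ᵇ k * b ]                                ≡⟨ indicator-yes (k * b ≟ k * b) refl ⟩
  1                                                 ∎
  where
  open ≡-Reasoning
  instance
    b≢0 = >-nonZero 1≤b
  vanish : ∀ j → j ≢ k → [ j * b ≡ᵇ k * b ] ≡ 0
  vanish j j≢k = indicator-no (j * b ≟ k * b) (j≢k ∘ *-cancelʳ-≡ j k b)

partS-singleton-≢0⇒∣ : ∀ b m → partS (b ∷ []) m ≢ 0 → b ∣ m
partS-singleton-≢0⇒∣ b m P≢0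
  with j , [jb≡m]≢0 ← sumRange-≢0 (suc m) _ (P≢0 ∘ trans (partS-singleton b m))
  = divides j (sym (indicator-≢0 (j * b ≟ m) [jb≡m]≢0))

nonnegSolutions : ℕ → ℕ → ℕ → ℕ
nonnegSolutions a b n = sumRange (suc n) λ i → sumRange (suc n) λ j → [ a * i + b * j ≡ᵇ n ]

p₂≡nonnegSolutions : ∀ a b n → 1 ≤ b → p₂ a b n ≡ nonnegSolutions a b n
p₂≡nonnegSolutions a b n 1≤b = sumRange-cong (suc n) (λ k _ → row k)
  where
  open ≡-Reasoning
  row : ∀ k → [ k * a ≤ᵇ n ] * partS (b ∷ []) (n ∸ k * a)
            ≡ sumRange (suc n) (λ j → [ a * k + b * j ≡ᵇ n ])
  row k with k * a ≤? n
  ... | yes ka≤n = begin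
    [ k * a ≤ᵇ n ] * partS (b ∷ []) (n ∸ k * a)
      ≡⟨ cong (_* partS (b ∷ []) (n ∸ k * a)) (indicator-yes (k * a ≤? n) ka≤n) ⟩
    1 * partS (b ∷ []) (n ∸ k * a)
      ≡⟨ *-identityˡ _ ⟩
    partS (b ∷ []) (n ∸ k * a)
      ≡⟨ partS-singleton b (n ∸ k * a) ⟩
    sumRange (suc (n ∸ k * a)) (λ j → [ j * b ≡ᵇ n ∸ k * a ])
      ≡⟨ sumRange-extend _ (s≤s (m∸n≤m n (k * a))) vanish ⟨
    sumRange (suc n) (λ j → [ j * b ≡ᵇ n ∸ k * a ])
      ≡⟨ sumRange-cong (suc n) (λ j _ →
           indicator-⇔ (solution⇔ j) (j * b ≟ n ∸ k * a) (a * k + b * j ≟ n)) ⟩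
    sumRange (suc n) (λ j → [ a * k + b * j ≡ᵇ n ])
      ∎
    where
    vanish : ∀ j → suc (n ∸ k * a) ≤ j → [ j * b ≡ᵇ n ∸ k * a ] ≡ 0
    vanish j n∸ka<j = indicator-no (j * b ≟ n ∸ k * a)
      (λ jb≡n∸ka → <⇒≱ n∸ka<j (subst (j ≤_) jb≡n∸ka (m≤m*n j b {{>-nonZero 1≤b}})))
    solution⇔ : ∀ j → j * b ≡ n ∸ k * a ⇔ a * k + b * j ≡ n
    solution⇔ j = mk⇔
      (λ jb≡n∸ka → trans comm (trans (cong (k * a +_) jb≡n∸ka) (m+[n∸m]≡n ka≤n)))
      (λ akbj≡n → trans (sym (m+n∸m≡n (k * a) (j * b)))
                        (cong (_∸ k * a) (trans (sym comm) akbj≡n)))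
      where
      comm : a * k + b * j ≡ k * a + j * b
      comm = cong₂ _+_ (*-comm a k) (*-comm b j)
  ... | no ka≰n = trans (cong (_* partS (b ∷ []) (n ∸ k * a)) (indicator-no (k * a ≤? n) ka≰n))
    (sym (sumRange-zero (suc n) (λ j _ → indicator-no (a * k + b * j ≟ n) (λ akbj≡n →
      ka≰n (subst (_≤ n) (*-comm a k) (subst (a * k ≤_) akbj≡n (m≤m+n (a * k) (b * j))))))))

nonnegSolutions-comm : ∀ a b n → nonnegSolutions a b n ≡ nonnegSolutions b a n
nonnegSolutions-comm a b n = trans (sumRange-swap (suc n) (suc n) _)
  (sumRange-cong (suc n) (λ j _ → sumRange-cong (suc n) (λ i _ →
    cong (λ x → [ x ≡ᵇ n ]) (+-comm (a * i) (b * j)))))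

p₂-comm : ∀ {a b} → 1 ≤ a → 1 ≤ b → p₂ a b ≗ p₂ b a
p₂-comm {a} {b} 1≤a 1≤b n = begin
  p₂ a b n              ≡⟨ p₂≡nonnegSolutions a b n 1≤b ⟩
  nonnegSolutions a b n ≡⟨ nonnegSolutions-comm a b n ⟩
  nonnegSolutions b a n ≡⟨ p₂≡nonnegSolutions b a n 1≤a ⟨
  p₂ b a n              ∎
  where open ≡-Reasoning

nonnegSolutions≡M : ∀ a b d → a ∤ d → b ∤ d → nonnegSolutions a b d ≡ M a b d
nonnegSolutions≡M a b d a∤d b∤d = begin
  nonnegSolutions a b d
    ≡⟨ sumRange-suc d _ ⟩
  sumRange (suc d) (λ j → [ a * 0 + b * j ≡ᵇ d ]) +
  sumRange d (λ i → sumRange (suc d) (λ j → [ a * suc i + b * j ≡ᵇ d ]))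
    ≡⟨ cong₂ _+_ (sumRange-zero (suc d) (λ j _ → column₀ j)) (sumRange-cong d (λ i _ → row i)) ⟩
  M a b d
    ∎
  where
  open ≡-Reasoning
  column₀ : ∀ j → [ a * 0 + b * j ≡ᵇ d ] ≡ 0
  column₀ j = indicator-no (a * 0 + b * j ≟ d) λ a0+bj≡d →
    b∤d (divides j (trans (sym a0+bj≡d) (trans (cong (_+ b * j) (*-zeroʳ a)) (*-comm b j))))
  row : ∀ i → sumRange (suc d) (λ j → [ a * suc i + b * j ≡ᵇ d ])
            ≡ sumRange d (λ j → [ a * suc i + b * suc j ≡ᵇ d ])
  row i = trans (sumRange-suc d _) (cong (_+ sumRange d (λ j → [ a * suc i + b * suc j ≡ᵇ d ])) row₀)
    where
    row₀ : [ a * suc i + b * 0 ≡ᵇ d ] ≡ 0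
    row₀ = indicator-no (a * suc i + b * 0 ≟ d) λ ai+b0≡d →
      a∤d (divides (suc i) (begin
        d                 ≡⟨ ai+b0≡d ⟨
        a * suc i + b * 0 ≡⟨ cong (a * suc i +_) (*-zeroʳ b) ⟩
        a * suc i + 0     ≡⟨ +-identityʳ _ ⟩
        a * suc i         ≡⟨ *-comm a (suc i) ⟩
        suc i * a         ∎))

p₂-+ : ∀ a b n → 1 ≤ a → p₂ a b (a + n) ≡ partS (b ∷ []) (a + n) + p₂ a b n
p₂-+ a b n 1≤a = begin
  p₂ a b (a + n)
    ≡⟨ sumRange-suc (a + n) (term (a + n)) ⟩
  1 * partS (b ∷ []) (a + n) + sumRange (a + n) (term (a + n) ∘ suc)
    ≡⟨ cong₂ _+_ (*-identityˡ _) (sumRange-cong (a + n) (λ k _ → shift k)) ⟩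
  partS (b ∷ []) (a + n) + sumRange (a + n) (term n)
    ≡⟨ cong (partS (b ∷ []) (a + n) +_) (sumRange-extend (term n) (+-monoˡ-≤ n 1≤a) vanish) ⟩
  partS (b ∷ []) (a + n) + p₂ a b n
    ∎
  where
  open ≡-Reasoning
  term : ℕ → ℕ → ℕ
  term m k = [ k * a ≤ᵇ m ] * partS (b ∷ []) (m ∸ k * a)
  shift : ∀ k → term (a + n) (suc k) ≡ term n k
  shift k = cong₂ _*_
    (indicator-⇔ (mk⇔ (+-cancelˡ-≤ a (k * a) n) (+-monoʳ-≤ a)) (a + k * a ≤? a + n) (k * a ≤? n))
    (cong (partS (b ∷ [])) ([m+n]∸[m+o]≡n∸o a n (k * a)))
  vanish : ∀ k → suc n ≤ k → term n k ≡ 0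
  vanish k n<k = cong (_* partS (b ∷ []) (n ∸ k * a))
    (indicator-no (k * a ≤? n) (<⇒≱ (≤-trans n<k (m≤m*n k a {{>-nonZero 1≤a}}))))

mod-+-cancelʳ : ∀ {L x y c d} → (x + c) ≡ (y + d) [mod L ] → c ≡ d [mod L ] → x ≡ y [mod L ]
mod-+-cancelʳ {L} {x} {y} {c} {d} x+c≡y+d c≡d =
  ℤ-Signed.∣⇒∣ᵤ {i = ℤ.+ x ℤ.- ℤ.+ y} (ℤ-Signed.∣m+n∣n⇒∣m
    (subst (ℤ-Signed._∣_ (ℤ.+ L)) difference (ℤ-Signed.∣ᵤ⇒∣ x+c≡y+d))
    (ℤ-Signed.∣ᵤ⇒∣ {i = ℤ.+ c ℤ.- ℤ.+ d} c≡d))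
  where
  rearrange : ∀ x y c d → (x ℤ.+ c) ℤ.- (y ℤ.+ d) ≡ (x ℤ.- y) ℤ.+ (c ℤ.- d)
  rearrange = ℤ-Solver.solve-∀
  difference : ℤ.+ (x + c) ℤ.- ℤ.+ (y + d) ≡ (ℤ.+ x ℤ.- ℤ.+ y) ℤ.+ (ℤ.+ c ℤ.- ℤ.+ d)
  difference = trans (cong₂ ℤ._-_ (ℤ.pos-+ x c) (ℤ.pos-+ y d))
                     (rearrange (ℤ.+ x) (ℤ.+ y) (ℤ.+ c) (ℤ.+ d))

≡1-mod⇒≢0 : ∀ {L x} → L ≢ 1 → x ≡ 1 [mod L ] → x ≢ 0
≡1-mod⇒≢0 L≢1 x≡1 refl = L≢1 (∣1⇒≡1 x≡1)

partS-singleton-periodic : ∀ {a b L π} → 1 ≤ a → IsPeriodMod (p₂ a b) L π →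
  ∀ m → a ≤ m → partS (b ∷ []) (m + π) ≡ partS (b ∷ []) m [mod L ]
partS-singleton-periodic {a} {b} {L} {π} 1≤a (_ , p₂-periodic) m a≤m =
  subst (λ x → P (x + π) ≡ P x [mod L ]) (m+[n∸m]≡n a≤m) (at-a+n (m ∸ a))
  where
  P : ℕ → ℕ
  P = partS (b ∷ [])
  at-a+n : ∀ n → P (a + n + π) ≡ P (a + n) [mod L ]
  at-a+n n = subst (λ x → P x ≡ P (a + n) [mod L ]) (sym (+-assoc a n π))
    (mod-+-cancelʳ {x = P (a + (n + π))} {y = P (a + n)}
      (subst₂ (λ x y → x ≡ y [mod L ])
        (trans (cong (p₂ a b) (+-assoc a n π)) (p₂-+ a b (n + π) 1≤a))
        (p₂-+ a b n 1≤a)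
        (p₂-periodic (a + n)))
      (p₂-periodic n))

period⇒∣ : ∀ {a b L π} → 1 ≤ a → 1 ≤ b → L ≢ 1 → IsPeriodMod (p₂ a b) L π → b ∣ π
period⇒∣ {a} {b} {L} {π} 1≤a 1≤b L≢1 period = ∣m+n∣m⇒∣n b∣ab+π (n∣m*n a)
  where
  P[ab+π]≡1 : partS (b ∷ []) (a * b + π) ≡ 1 [mod L ]
  P[ab+π]≡1 = subst (λ x → partS (b ∷ []) (a * b + π) ≡ x [mod L ])
    (partS-singleton-multiple a 1≤b)
    (partS-singleton-periodic 1≤a period (a * b) (m≤m*n a b {{>-nonZero 1≤b}}))
  b∣ab+π : b ∣ a * b + π
  b∣ab+π = partS-singleton-≢0⇒∣ b (a * b + π) (≡1-mod⇒≢0 L≢1 P[ab+π]≡1)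

IsPeriodMod-cong : ∀ {α β : ℕ → ℕ} {L d} → α ≗ β → IsPeriodMod α L d → IsPeriodMod β L d
IsPeriodMod-cong {L = L} {d} α≗β (1≤d , α-periodic) =
  1≤d , λ n → subst₂ (λ x y → x ≡ y [mod L ]) (α≗β (n + d)) (α≗β n) (α-periodic n)

M≡p₂ : ∀ {a b d} → 1 ≤ b → a ∤ d → b ∤ d → M a b d ≡ p₂ a b d
M≡p₂ {a} {b} {d} 1≤b a∤d b∤d =
  sym (trans (p₂≡nonnegSolutions a b d 1≤b) (nonnegSolutions≡M a b d a∤d b∤d))

prime^N≢1 : ∀ {ℓ} N → Prime ℓ → 1 ≤ N → ℓ ^ N ≢ 1
prime^N≢1 {ℓ} N ℓ-prime 1≤N ℓ^N≡1 with m^n≡1⇒n≡0∨m≡1 ℓ N ℓ^N≡1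
... | inj₁ refl = n≮n 0 1≤N
... | inj₂ refl = nonTrivial⇒≢1 {{prime⇒nonTrivial ℓ-prime}} refl

coprime⇒∤ : ∀ {m n} → 2 ≤ m → Coprime m n → m ∤ n
coprime⇒∤ 2≤m m⊥n m∣n = >⇒≢ 2≤m (m⊥n (∣-refl , m∣n))

∤∣⇒∤+ : ∀ {m n o} → m ∤ n → m ∣ o → m ∤ n + o
∤∣⇒∤+ {m} {n} {o} m∤n m∣o m∣n+o =
  m∤n (∣m+n∣m⇒∣n (subst (m ∣_) (+-comm n o) m∣n+o) m∣o)

lemma2p2 : (a b c : ℕ) → 2 ≤ a → 2 ≤ b → 2 ≤ c →
    Coprime a b → Coprime a c → Coprime b c →
    (M a b c ≡ p₂ a b c) ×
    ((N ℓ π : ℕ) → 1 ≤ N → Prime ℓ →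
      IsMinPeriodMod (p₂ a b) (ℓ ^ N) π →
      M a b (c + π) ≡ M a b c [mod ℓ ^ N ])
lemma2p2 a b c 2≤a 2≤b _ _ a⊥c b⊥c = M≡p₂ 1≤b a∤c b∤c , shift
  where
  1≤a : 1 ≤ a
  1≤a = <⇒≤ 2≤a
  1≤b : 1 ≤ b
  1≤b = <⇒≤ 2≤b
  a∤c : a ∤ c
  a∤c = coprime⇒∤ 2≤a a⊥c
  b∤c : b ∤ c
  b∤c = coprime⇒∤ 2≤b b⊥c
  shift : (N ℓ π : ℕ) → 1 ≤ N → Prime ℓ → IsMinPeriodMod (p₂ a b) (ℓ ^ N) π →
          M a b (c + π) ≡ M a b c [mod ℓ ^ N ]
  shift N ℓ π 1≤N ℓ-prime (period@(_ , p₂-periodic) , _) =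
    subst₂ (λ x y → x ≡ y [mod ℓ ^ N ])
      (sym (M≡p₂ 1≤b (∤∣⇒∤+ a∤c a∣π) (∤∣⇒∤+ b∤c b∣π)))
      (sym (M≡p₂ 1≤b a∤c b∤c))
      (p₂-periodic c)
    where
    ℓ^N≢1 : ℓ ^ N ≢ 1
    ℓ^N≢1 = prime^N≢1 N ℓ-prime 1≤N
    b∣π : b ∣ π
    b∣π = period⇒∣ 1≤a 1≤b ℓ^N≢1 period
    a∣π : a ∣ π
    a∣π = period⇒∣ 1≤b 1≤a ℓ^N≢1 (IsPeriodMod-cong (p₂-comm 1≤a 1≤b) period)
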